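{- Let $G=(V,E)$ be a double star of order $n$. Then $DOM^+_{maj}(G)=0$ if $n$ is even and $DOM^+_{maj}(G)=1$ if $n$ is odd. Moreover, if $n\geq13$ and no vertex of $G$ has degree $2$, then $dom^+_{maj}(G)=-4$ if $n$ is even and $dom^+_{maj}(G)=-3$ if $n$ is odd; and if $5\leq n<13$, or if $n\geq 13$ and some vertex of $G$ has degree $2$, then $dom^+_{maj}(G)=-2$ if $n$ is even and $dom^+_{maj}(G)=-1$ if $n$ is odd.
   Context: A double star is the graph obtained from two disjoint stars by joining their central vertices by an edge (the two centers are the stem vertices). Digraphs are finite, without loops or multiple arcs. For a digraph $D=(V,A)$ and $u\in V$, $N^+[u]=\{u\}\cup\{v: uv\in A\}$; for $f:V\to\{ -1,1\}$ and $X\subseteq V$, $f(X)=\sum_{v\in X}f(v)$. A majority out-dominating function (MODF) of $D$ is $f:V\to\{ -1,1\}$ with $|\{v: f(N^+[v])\geq1\}|\geq|V|/2$; its weight is $f(V)$; $\gamma^+_{maj}(D)$ is the minimum weight of a MODF. An orientation of a graph $G=(V,E)$ is a digraph $(V,A)$ obtained by replacing each edge $uv$ by exactly one of the arcs $uv$, $vu$. $dom^+_{maj}(G)$ and $DOM^+_{maj}(G)$ are the minimum and maximum of $\gamma^+_{maj}(D)$ over all orientations $D$ of $G$. -}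

module Defs where

open import Data.Bool using (Bool; true; false; if_then_else_)
open import Data.Nat as ℕ using (ℕ; zero; suc; _≤_; _<_)
open import Data.Fin using (Fin; toℕ) renaming (zero to fz; suc to fs)
open import Data.Integer as ℤ using (ℤ; +_; -_; 1ℤ; 0ℤ; -1ℤ)
open import Data.Product using (Σ; ∃; _×_; _,_)
open import Data.Sum using (_⊎_)
open import Relation.Nullary using (does)
open import Relation.Binary.PropositionalEquality using (_≡_)
open import Function.Bundles using (_↔_; Inverse)

Σℤ : ∀ {n} → (Fin n → ℤ) → ℤ
Σℤ {zero}  g = 0ℤ
Σℤ {suc n} g = g fz ℤ.+ Σℤ (λ i → g (fs i))

count : ∀ {n} → (Fin n → Bool) → ℕ
count {zero}  p = 0
count {suc n} p = (if p fz then 1 else 0) ℕ.+ count (λ i → p (fs i))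

record Graph (n : ℕ) : Set where
  field
    adj    : Fin n → Fin n → Bool
    sym    : ∀ u v → adj u v ≡ adj v u
    irrefl : ∀ u → adj u u ≡ false
open Graph public

deg : ∀ {n} → Graph n → Fin n → ℕ
deg G v = count (adj G v)

record Digraph (n : ℕ) : Set where
  field
    arc    : Fin n → Fin n → Bool
    noLoop : ∀ u → arc u u ≡ false
open Digraph public

IsOrientation : ∀ {n} → Graph n → Digraph n → Set
IsOrientation G D =
  (∀ u v → arc D u v ≡ true → adj G u v ≡ true) ×
  (∀ u v → adj G u v ≡ true →
     (arc D u v ≡ true × arc D v u ≡ false) ⊎ (arc D u v ≡ false × arc D v u ≡ true))

-- Majority out-domination.  A function f : V → {-1,1} is encoded by
-- f : Fin n → Bool (true ↦ 1, false ↦ -1).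

sgn : Bool → ℤ
sgn true  = 1ℤ
sgn false = -1ℤ

weight : ∀ {n} → (Fin n → Bool) → ℤ
weight f = Σℤ (λ v → sgn (f v))

closedOutSum : ∀ {n} → Digraph n → (Fin n → Bool) → Fin n → ℤ
closedOutSum D f u = sgn (f u) ℤ.+ Σℤ (λ v → if arc D u v then sgn (f v) else 0ℤ)

goodCount : ∀ {n} → Digraph n → (Fin n → Bool) → ℕ
goodCount D f = count (λ u → does (1ℤ ℤ.≤? closedOutSum D f u))

-- |{u : f(N⁺[u]) ≥ 1}| ≥ |V|/2, i.e. 2·|{…}| ≥ n
IsMODF : ∀ {n} → Digraph n → (Fin n → Bool) → Set
IsMODF {n} D f = n ≤ 2 ℕ.* goodCount D f

IsGammaMaj : ∀ {n} → Digraph n → ℤ → Set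
IsGammaMaj D k =
  (∃ λ f → IsMODF D f × weight f ≡ k) ×
  (∀ f → IsMODF D f → k ℤ.≤ weight f)

IsDomMaj : ∀ {n} → Graph n → ℤ → Set
IsDomMaj G k =
  (∃ λ D → IsOrientation G D × IsGammaMaj D k) ×
  (∀ D → IsOrientation G D → ∀ j → IsGammaMaj D j → k ℤ.≤ j)

IsDOMMaj : ∀ {n} → Graph n → ℤ → Set
IsDOMMaj G k =
  (∃ λ D → IsOrientation G D × IsGammaMaj D k) ×
  (∀ D → IsOrientation G D → ∀ j → IsGammaMaj D j → j ℤ.≤ k)

-- The double star S(a,b) on Fin (2 + a + b): vertex 0 and vertex 1 are
-- the stem vertices (adjacent), vertices 2 … a+1 are the leaves of
-- vertex 0, vertices a+2 … a+b+1 are the leaves of vertex 1.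

data Role : Set where
  stemX stemY leafX leafY : Role

role : (a b : ℕ) → Fin (2 ℕ.+ a ℕ.+ b) → Role
role a b i with toℕ i
... | zero = stemX
... | suc zero = stemY
... | suc (suc k) = if does (k ℕ.<? a) then leafX else leafY

roleAdj : Role → Role → Bool
roleAdj stemX stemY = true
roleAdj stemY stemX = true
roleAdj stemX leafX = true
roleAdj leafX stemX = true
roleAdj stemY leafY = true
roleAdj leafY stemY = true
roleAdj _     _     = false

roleAdj-sym : ∀ r s → roleAdj r s ≡ roleAdj s r
roleAdj-sym stemX stemX = _≡_.refl
roleAdj-sym stemX stemY = _≡_.refl
roleAdj-sym stemX leafX = _≡_.refl
roleAdj-sym stemX leafY = _≡_.refl
roleAdj-sym stemY stemX = _≡_.refl
roleAdj-sym stemY stemY = _≡_.refl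
roleAdj-sym stemY leafX = _≡_.refl
roleAdj-sym stemY leafY = _≡_.refl
roleAdj-sym leafX stemX = _≡_.refl
roleAdj-sym leafX stemY = _≡_.refl
roleAdj-sym leafX leafX = _≡_.refl
roleAdj-sym leafX leafY = _≡_.refl
roleAdj-sym leafY stemX = _≡_.refl
roleAdj-sym leafY stemY = _≡_.refl
roleAdj-sym leafY leafX = _≡_.refl
roleAdj-sym leafY leafY = _≡_.refl

roleAdj-irr : ∀ r → roleAdj r r ≡ false
roleAdj-irr stemX = _≡_.refl
roleAdj-irr stemY = _≡_.refl
roleAdj-irr leafX = _≡_.refl
roleAdj-irr leafY = _≡_.refl

doubleStar : (a b : ℕ) → Graph (2 ℕ.+ a ℕ.+ b)
doubleStar a b = record
  { adj    = λ u v → roleAdj (role a b u) (role a b v)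
  ; sym    = λ u v → roleAdj-sym (role a b u) (role a b v)
  ; irrefl = λ u → roleAdj-irr (role a b u)
  }

IsDoubleStar : ∀ {n} → Graph n → Set
IsDoubleStar {n} G =
  Σ ℕ λ a → Σ ℕ λ b → 1 ≤ a × 1 ≤ b ×
  Σ (Fin n ↔ Fin (2 ℕ.+ a ℕ.+ b)) λ φ →
    ∀ u v → adj G u v ≡ adj (doubleStar a b) (Inverse.to φ u) (Inverse.to φ v)

-- An MODF with
-- P positive vertices has weight 2P − n, so γ⁺_maj, dom⁺_maj and DOM⁺_maj are
-- determined by bounds on P (gamma-/dom-/DOM-from-counts).  A vertex u is good
-- (f(N⁺[u]) ≥ 1) iff N⁺[u] has more + than − vertices; so a + vertex with only
-- + out-neighbours is good, and a vertex of out-degree ≤ 1 is good only if +.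
--
-- In the double star S(a,b) on N = a + b + 2 vertices leaves have out-degree
-- ≤ 1, so only the two stems can be good without being +: N ≤ 2(P + 2).  When
-- P + 2 vertices are good, both stems are −, good, and see at least two + leaves
-- each, forcing a, b ≥ 2 and N ≥ 13; otherwise N ≤ 2(P + 1).  Fan orientations,
-- whose stems point at prescribed numbers of + leaves, attain these bounds.  For
-- DOM⁺_maj, every orientation has a closed labelling (+ set closed under
-- out-arcs) with ⌈N/2⌉ vertices, which is an MODF, while in the inward fan all
-- out-degrees are ≤ 1, forcing P ≥ ⌈N/2⌉.  The values transfer along the
-- isomorphism from S(a,b) to G, and the parity of N gives the stated numbers.

module Submission where

open import Defs
open import Data.Nat using (ℕ; _≤_; _<_; _%_)
open import Data.Fin using (Fin)
open import Data.Integer using (+_; -[1+_])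
open import Data.Product using (_×_; ∃)
open import Data.Sum using (_⊎_)
open import Relation.Nullary using (¬_)
open import Relation.Binary.PropositionalEquality using (_≡_)

open import Data.Bool using (Bool; true; false; if_then_else_; _∧_; _∨_; not; T)
open import Data.Bool.Properties using (∧-zeroʳ; ∧-identityʳ; ∨-zeroʳ; ∨-identityʳ)
open import Data.Nat using (zero; suc; _+_; _*_; _∸_; _⊓_; _/_; z≤n; s≤s; s≤s⁻¹; _<ᵇ_; _<?_; _≤?_; _≟_)
open import Data.Nat.DivMod using (m≡m%n+[m/n]*n)
open import Data.Nat.Properties
  using (≤-refl; ≤-trans; ≤-reflexive; ≤-antisym; n≤1+n; <⇒≤; <⇒≱; ≰⇒>; ≮⇒≥; ≤∧≢⇒<; n≤0⇒n≡0;
         <ᵇ⇒<; <⇒<ᵇ; suc-injective;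
         +-comm; +-assoc; +-suc; +-identityʳ; +-mono-≤; +-monoʳ-≤; +-monoˡ-≤;
         +-cancelˡ-≡; +-cancelˡ-≤; +-cancelʳ-≤; m≤m+n; m≤n+m; m<m+n; m≤n⇒∃[o]m+o≡n;
         *-comm; *-suc; *-distribˡ-+; *-monoʳ-≤; *-cancelˡ-<;
         m+n∸m≡n; m+[n∸m]≡n; m≤n+o⇒m∸n≤o; m<n⇒0<n∸m; m⊓n≤m; m⊓n+n∸m≡n; m≤n⇒m⊓n≡m; ⊓-zeroʳ;
         +-0-commutativeMonoid; +-commutativeSemigroup; module ≤-Reasoning)
open import Data.Fin using (toℕ) renaming (zero to fz; suc to fs)
open import Data.Fin.Permutation using (↔⇒≡)
open import Data.Integer using (ℤ; _⊖_; 0ℤ; 1ℤ)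
import Data.Integer as ℤ
import Data.Integer.Properties as ℤₚ
open import Data.Product using (Σ; _,_; proj₁; proj₂; map)
open import Data.Sum using (inj₁; inj₂; [_,_]; [_,_]′)
open import Data.Unit using (tt)
open import Relation.Nullary using (does; yes; no; contradiction)
open import Relation.Nullary.Decidable using (map′; does-≡)
open import Relation.Binary.PropositionalEquality using (refl; trans; cong; cong₂; subst; subst₂; module ≡-Reasoning)
  renaming (sym to ≡-sym)
open import Function using (_∘_)
open import Function.Bundles using (_↔_; Inverse)
import Algebra.Properties.CommutativeMonoid.Sum as MonoidSum
open import Algebra.Properties.CommutativeSemigroup +-commutativeSemigroup
  using (interchange)

𝟙 : Bool → ℕ
𝟙 b = if b then 1 else 0

𝟙≤1 : ∀ b → 𝟙 b ≤ 1
𝟙≤1 true  = ≤-refl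
𝟙≤1 false = z≤n

𝟙-mono : ∀ {x y} → (x ≡ true → y ≡ true) → 𝟙 x ≤ 𝟙 y
𝟙-mono {false} x⇒y = z≤n
𝟙-mono {true}  x⇒y rewrite x⇒y refl = ≤-refl

∧-elimˡ : ∀ {x y} → x ∧ y ≡ true → x ≡ true
∧-elimˡ {true} _ = refl

∧-elimʳ : ∀ {x y} → x ∧ y ≡ true → y ≡ true
∧-elimʳ {true} y = y

not-true : ∀ {x} → not x ≡ true → x ≡ false
not-true {false} _ = refl

∧-not : ∀ x y → (x ∧ y) ∧ not y ≡ false
∧-not false y     = refl
∧-not true  true  = refl
∧-not true  false = refl

∧-dup : ∀ x y → (x ∧ y) ∧ y ≡ x ∧ y
∧-dup false y     = refl
∧-dup true  true  = refl
∧-dup true  false = refl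

∧-∨-left : ∀ s x y → (x ≡ true → s ≡ true) → (y ≡ true → s ≡ false) → s ∧ (x ∨ y) ≡ x
∧-∨-left true  x     false _   _   = ∨-identityʳ x
∧-∨-left true  x     true  _   y⇒¬s = contradiction (y⇒¬s refl) λ ()
∧-∨-left false false y     _   _   = refl
∧-∨-left false true  y     x⇒s _   = contradiction (x⇒s refl) λ ()

∧-∨-right : ∀ s x y → (x ≡ true → s ≡ true) → (y ≡ true → s ≡ false) → not s ∧ (x ∨ y) ≡ y
∧-∨-right true  x     false _   _    = refl
∧-∨-right true  x     true  _   y⇒¬s = contradiction (y⇒¬s refl) λ ()
∧-∨-right false false y     _   _    = refl
∧-∨-right false true  y     x⇒s _    = contradiction (x⇒s refl) λ ()

∨-cases : ∀ {x y} → x ∨ y ≡ true → x ≡ true ⊎ y ≡ true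
∨-cases {true}  _ = inj₁ refl
∨-cases {false} y = inj₂ y

contraposeᵇ : ∀ {b c} → (b ≡ false → c ≡ false) → c ≡ true → b ≡ true
contraposeᵇ {true}  _ _  = refl
contraposeᵇ {false} h ct = trans (≡-sym (h refl)) ct

<ᵇ⇒<′ : ∀ {m n} → (m <ᵇ n) ≡ true → m < n
<ᵇ⇒<′ {m} {n} e = <ᵇ⇒< m n (subst T (≡-sym e) tt)

<⇒<ᵇ′ : ∀ {m n} → m < n → (m <ᵇ n) ≡ true
<⇒<ᵇ′ {m} {n} m<n with m <ᵇ n | <⇒<ᵇ m<n
... | true | _ = refl

≥⇒≮ᵇ : ∀ {m n} → n ≤ m → (m <ᵇ n) ≡ false
≥⇒≮ᵇ z≤n     = refl
≥⇒≮ᵇ (s≤s h) = ≥⇒≮ᵇ h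

indicators-forced : ∀ fx fy gx gy → 2 + (𝟙 fx + 𝟙 fy) ≤ 𝟙 gx + 𝟙 gy →
               fx ≡ false × fy ≡ false × gx ≡ true × gy ≡ true
indicators-forced fx fy gx gy h with sum≡0 (n≤0⇒n≡0 (s≤s⁻¹ (s≤s⁻¹ (≤-trans h (𝟙+𝟙≤2 gx gy)))))
                              | sum≡2 (≤-antisym (𝟙+𝟙≤2 gx gy) (≤-trans (m≤m+n 2 _) h))
  where
  𝟙+𝟙≤2 : ∀ x y → 𝟙 x + 𝟙 y ≤ 2
  𝟙+𝟙≤2 x y = +-mono-≤ (𝟙≤1 x) (𝟙≤1 y)
  sum≡0 : ∀ {x y} → 𝟙 x + 𝟙 y ≡ 0 → x ≡ false × y ≡ false
  sum≡0 {false} {false} _ = refl , refl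
  sum≡0 {false} {true}  ()
  sum≡0 {true}          ()
  sum≡2 : ∀ {x y} → 𝟙 x + 𝟙 y ≡ 2 → x ≡ true × y ≡ true
  sum≡2 {true}  {true}  _ = refl , refl
  sum≡2 {true}  {false} ()
  sum≡2 {false} {true}  ()
  sum≡2 {false} {false} ()
... | fx≡false , fy≡false | gx≡true , gy≡true = fx≡false , fy≡false , gx≡true , gy≡true

halve : ∀ {c P} → 2 * c ≤ suc (2 * P) → c ≤ P
halve {c} {P} 2c≤1+2P = s≤s⁻¹ (*-cancelˡ-< 2 c (suc P)
  (subst (suc (2 * c) ≤_) (≡-sym (*-suc 2 P)) (s≤s 2c≤1+2P)))

even-half : ∀ n → n % 2 ≡ 0 → n + 0 ≡ 2 * (n / 2)
even-half n n%2≡0 = begin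
  n + 0                  ≡⟨ +-identityʳ n ⟩
  n                      ≡⟨ m≡m%n+[m/n]*n n 2 ⟩
  n % 2 + n / 2 * 2      ≡⟨ cong (λ r → r + n / 2 * 2) n%2≡0 ⟩
  n / 2 * 2              ≡⟨ *-comm (n / 2) 2 ⟩
  2 * (n / 2)            ∎
  where open ≡-Reasoning

odd-half : ∀ n → n % 2 ≡ 1 → n + 1 ≡ 2 * suc (n / 2)
odd-half n n%2≡1 = begin
  n + 1                  ≡⟨ +-comm n 1 ⟩
  suc n                  ≡⟨ cong suc (m≡m%n+[m/n]*n n 2) ⟩
  suc (n % 2 + n / 2 * 2) ≡⟨ cong (λ r → suc (r + n / 2 * 2)) n%2≡1 ⟩
  2 + n / 2 * 2          ≡⟨ cong (λ m → 2 + m) (*-comm (n / 2) 2) ⟩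
  2 + 2 * (n / 2)        ≡⟨ ≡-sym (*-suc 2 (n / 2)) ⟩
  2 * suc (n / 2)        ∎
  where open ≡-Reasoning

⊖-above : ∀ n t → (n + t) ⊖ n ≡ + t
⊖-above n t = trans (ℤₚ.⊖-≥ (m≤m+n n t)) (cong +_ (m+n∸m≡n n t))

⊖-below : ∀ n t → n ⊖ (n + suc t) ≡ -[1+ t ]
⊖-below n t = trans (ℤₚ.⊖-< (m<m+n n (s≤s z≤n))) (cong (λ m → ℤ.- (+ m)) (m+n∸m≡n n (suc t)))

split-between : ∀ {lo₁ lo₂ a b c} → lo₁ ≤ a → lo₂ ≤ b → lo₁ + lo₂ ≤ c → c ≤ a + b →
  Σ ℕ λ t₁ → Σ ℕ λ t₂ → lo₁ ≤ t₁ × t₁ ≤ a × lo₂ ≤ t₂ × t₂ ≤ b × t₁ + t₂ ≡ c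
split-between {lo₁} {lo₂} lo₁≤a lo₂≤b lo≤c c≤a+b
  with m≤n⇒∃[o]m+o≡n lo₁≤a | m≤n⇒∃[o]m+o≡n lo₂≤b | m≤n⇒∃[o]m+o≡n lo≤c
... | p , refl | q , refl | r , refl =
  lo₁ + p ⊓ r , lo₂ + (r ∸ p) , m≤m+n lo₁ _ , +-monoʳ-≤ lo₁ (m⊓n≤m p r) ,
  m≤m+n lo₂ _ , +-monoʳ-≤ lo₂ (m≤n+o⇒m∸n≤o r p r≤p+q) , sum≡
  where
  r≤p+q : r ≤ p + q
  r≤p+q = +-cancelˡ-≤ (lo₁ + lo₂) r (p + q)
            (subst (lo₁ + lo₂ + r ≤_) (interchange lo₁ p lo₂ q) c≤a+b)
  sum≡ : (lo₁ + p ⊓ r) + (lo₂ + (r ∸ p)) ≡ lo₁ + lo₂ + r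
  sum≡ = trans (interchange lo₁ (p ⊓ r) lo₂ (r ∸ p)) (cong (λ z → lo₁ + lo₂ + z) (m⊓n+n∸m≡n p r))

count-ext : ∀ {m} {p q : Fin m → Bool} → (∀ i → p i ≡ q i) → count p ≡ count q
count-ext {zero}  p≗q = refl
count-ext {suc m} p≗q = cong₂ (λ x y → 𝟙 x + y) (p≗q fz) (count-ext (p≗q ∘ fs))

count-mono : ∀ {m} {p q : Fin m → Bool} → (∀ i → p i ≡ true → q i ≡ true) → count p ≤ count q
count-mono {zero}  p⊆q = z≤n
count-mono {suc m} p⊆q = +-mono-≤ (𝟙-mono (p⊆q fz)) (count-mono (p⊆q ∘ fs))

count-none : ∀ {m} {p : Fin m → Bool} → (∀ i → p i ≡ false) → count p ≡ 0
count-none {zero}  none = refl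
count-none {suc m} none rewrite none fz = count-none (none ∘ fs)

𝟙≤count : ∀ {m} (p : Fin m → Bool) i → 𝟙 (p i) ≤ count p
𝟙≤count p fz     = m≤m+n _ _
𝟙≤count p (fs i) = ≤-trans (𝟙≤count (p ∘ fs) i) (m≤n+m _ _)

count-complement : ∀ {m} (p : Fin m → Bool) → count p + count (not ∘ p) ≡ m
count-complement {zero}  p = refl
count-complement {suc m} p with p fz | count-complement (p ∘ fs)
... | true  | ih = cong suc ih
... | false | ih = trans (+-suc _ _) (cong suc ih)

count-∨ : ∀ {m} (p q : Fin m → Bool) → (∀ i → p i ∧ q i ≡ false) →
          count (λ i → p i ∨ q i) ≡ count p + count q
count-∨ {zero}  p q disj = refl
count-∨ {suc m} p q disj with p fz | q fz | disj fz | count-∨ (p ∘ fs) (q ∘ fs) (disj ∘ fs)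
... | false | false | _ | ih = ih
... | false | true  | _ | ih = trans (cong suc ih) (≡-sym (+-suc _ _))
... | true  | false | _ | ih = cong suc ih
... | true  | true  | () | _

count-below : ∀ m t → count {m} (λ i → toℕ i <ᵇ t) ≡ t ⊓ m
count-below zero    t       = ≡-sym (⊓-zeroʳ t)
count-below (suc m) zero    = count-none {suc m} (λ i → refl)
count-below (suc m) (suc t) = cong suc (count-below m t)

-- `take p j` keeps the first j indices satisfying p
take : ∀ {m} → (Fin m → Bool) → ℕ → Fin m → Bool
take p zero    i      = false
take p (suc j) fz     = p fz
take p (suc j) (fs i) = take (p ∘ fs) (if p fz then j else suc j) i

take-⊆ : ∀ {m} (p : Fin m → Bool) j i → take p j i ≡ true → p i ≡ true
take-⊆ p zero    i      ()
take-⊆ p (suc j) fz     pi = pi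
take-⊆ p (suc j) (fs i) h  = take-⊆ (p ∘ fs) (if p fz then j else suc j) i h

take-count : ∀ {m} (p : Fin m → Bool) j → count (take p j) ≡ j ⊓ count p
take-count {zero}  p j       = ≡-sym (⊓-zeroʳ j)
take-count {suc m} p zero    = count-none {suc m} (λ i → refl)
take-count {suc m} p (suc j) with p fz
... | true  = cong suc (take-count (p ∘ fs) j)
... | false = take-count (p ∘ fs) (suc j)

take-count-≤ : ∀ {m} (p : Fin m → Bool) {j} → j ≤ count p → count (take p j) ≡ j
take-count-≤ p {j} j≤ = trans (take-count p j) (m≤n⇒m⊓n≡m j≤)

module ℕΣ = MonoidSum +-0-commutativeMonoid

count≡sum : ∀ {m} (p : Fin m → Bool) → count p ≡ ℕΣ.sum (𝟙 ∘ p)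
count≡sum {zero}  p = refl
count≡sum {suc m} p = cong (λ s → 𝟙 (p fz) + s) (count≡sum (p ∘ fs))

count-permute : ∀ {m n} (π : Fin n ↔ Fin m) (p : Fin m → Bool) →
                count p ≡ count (p ∘ Inverse.to π)
count-permute π p = begin
  count p                         ≡⟨ count≡sum p ⟩
  ℕΣ.sum (𝟙 ∘ p)                  ≡⟨ ℕΣ.sum-permute (𝟙 ∘ p) π ⟩
  ℕΣ.sum (𝟙 ∘ p ∘ Inverse.to π)   ≡⟨ ≡-sym (count≡sum (p ∘ Inverse.to π)) ⟩
  count (p ∘ Inverse.to π)        ∎
  where open ≡-Reasoning

sgn-step : ∀ b A C → sgn b ℤ.+ (A ⊖ C) ≡ (𝟙 b + A) ⊖ (𝟙 (not b) + C)
sgn-step true  A C = ℤₚ.distribʳ-⊖-+-pos 1 A C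
sgn-step false A C = ℤₚ.distribʳ-⊖-+-neg 0 A C

Σℤ-masked : ∀ {m} (q f : Fin m → Bool) →
  Σℤ (λ v → if q v then sgn (f v) else 0ℤ) ≡ count (λ v → q v ∧ f v) ⊖ count (λ v → q v ∧ not (f v))
Σℤ-masked {zero}  q f = refl
Σℤ-masked {suc m} q f with q fz
... | false = trans (ℤₚ.+-identityˡ _) (Σℤ-masked (q ∘ fs) (f ∘ fs))
... | true  = trans (cong (λ s → sgn (f fz) ℤ.+ s) (Σℤ-masked (q ∘ fs) (f ∘ fs))) (sgn-step (f fz) _ _)

weight≡ : ∀ {n} (f : Fin n → Bool) → weight f ≡ (2 * count f) ⊖ n
weight≡ {n} f = begin
  weight f                  ≡⟨ Σℤ-masked (λ _ → true) f ⟩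
  P ⊖ M                     ≡⟨ ≡-sym (ℤₚ.+-cancelˡ-⊖ P P M) ⟩
  (P + P) ⊖ (P + M)         ≡⟨ cong₂ _⊖_ (cong (λ s → P + s) (≡-sym (+-identityʳ P))) (count-complement f) ⟩
  (2 * P) ⊖ n               ∎
  where open ≡-Reasoning
        P = count f
        M = count (not ∘ f)

pos⁺ neg⁺ : ∀ {n} → Digraph n → (Fin n → Bool) → Fin n → ℕ
pos⁺ D f u = 𝟙 (f u) + count (λ v → arc D u v ∧ f v)
neg⁺ D f u = 𝟙 (not (f u)) + count (λ v → arc D u v ∧ not (f v))

good : ∀ {n} → Digraph n → (Fin n → Bool) → Fin n → Bool
good D f u = does (1ℤ ℤ.≤? closedOutSum D f u)

closedOutSum≡ : ∀ {n} (D : Digraph n) f u → closedOutSum D f u ≡ pos⁺ D f u ⊖ neg⁺ D f u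
closedOutSum≡ D f u =
  trans (cong (λ s → sgn (f u) ℤ.+ s) (Σℤ-masked (arc D u) f)) (sgn-step (f u) _ _)

1≤⊖⇒< : ∀ p q → 1ℤ ℤ.≤ p ⊖ q → q < p
1≤⊖⇒< p q 1≤p⊖q with q <? p
... | yes q<p = q<p
... | no  q≮p = contradiction (ℤₚ.≤-trans 1≤p⊖q p⊖q≤0) λ { (ℤ.+≤+ ()) }
  where p⊖q≤0 : p ⊖ q ℤ.≤ 0ℤ
        p⊖q≤0 = ℤₚ.≤-trans (ℤₚ.⊖-monoˡ-≤ q (≮⇒≥ q≮p)) (ℤₚ.≤-reflexive (ℤₚ.n⊖n≡0 q))

<⇒1≤⊖ : ∀ p q → q < p → 1ℤ ℤ.≤ p ⊖ q
<⇒1≤⊖ p q q<p rewrite ℤₚ.⊖-≥ (<⇒≤ q<p) = ℤ.+≤+ (m<n⇒0<n∸m q<p)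

good≡ : ∀ {n} (D : Digraph n) f u → good D f u ≡ (neg⁺ D f u <ᵇ pos⁺ D f u)
good≡ D f u rewrite closedOutSum≡ D f u =
  does-≡ (1ℤ ℤ.≤? (p ⊖ q)) (map′ (<⇒1≤⊖ p q) (1≤⊖⇒< p q) (q <? p))
  where p = pos⁺ D f u
        q = neg⁺ D f u

no-negative-out : ∀ {n} (D : Digraph n) (f : Fin n → Bool) u → (∀ v → arc D u v ≡ true → f v ≡ true) →
                  count (λ v → arc D u v ∧ not (f v)) ≡ 0
no-negative-out D f u closed = count-none {p = λ v → arc D u v ∧ not (f v)} noMinus
  where noMinus : ∀ v → arc D u v ∧ not (f v) ≡ false
        noMinus v with arc D u v in uv
        ... | false = refl
        ... | true  rewrite closed v uv = refl

good-if-closed : ∀ {n} (D : Digraph n) f u → f u ≡ true →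
                 (∀ v → arc D u v ≡ true → f v ≡ true) → good D f u ≡ true
good-if-closed D f u fu closed = begin
  good D f u                        ≡⟨ good≡ D f u ⟩
  neg⁺ D f u <ᵇ pos⁺ D f u          ≡⟨ cong₂ _<ᵇ_ neg≡0 pos≡1+ ⟩
  0 <ᵇ suc (count (λ v → arc D u v ∧ f v))  ≡⟨⟩
  true                              ∎
  where open ≡-Reasoning
        neg≡0 : neg⁺ D f u ≡ 0
        neg≡0 = cong₂ _+_ (cong (𝟙 ∘ not) fu) (no-negative-out D f u closed)
        pos≡1+ : pos⁺ D f u ≡ suc (count (λ v → arc D u v ∧ f v))
        pos≡1+ = cong (λ b → 𝟙 b + count (λ v → arc D u v ∧ f v)) fu

good-negative : ∀ {n} (D : Digraph n) f u → f u ≡ false →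
  good D f u ≡ (suc (count (λ v → arc D u v ∧ not (f v))) <ᵇ count (λ v → arc D u v ∧ f v))
good-negative D f u fu rewrite good≡ D f u | fu = refl

good-if-negative : ∀ {n} (D : Digraph n) f u → f u ≡ false →
  2 + count (λ v → arc D u v ∧ not (f v)) ≤ count (λ v → arc D u v ∧ f v) → good D f u ≡ true
good-if-negative D f u fu 2+neg≤pos = trans (good-negative D f u fu) (<⇒<ᵇ′ 2+neg≤pos)

-- a − vertex of out-degree at most 1 is not good: it sees at most one + vertex
not-good-outdeg≤1 : ∀ {n} (D : Digraph n) f u → count (arc D u) ≤ 1 → f u ≡ false → good D f u ≡ false
not-good-outdeg≤1 D f u outdeg≤1 fu =
  trans (good-negative D f u fu) (≥⇒≮ᵇ (≤-trans pos≤outdeg (≤-trans outdeg≤1 (s≤s z≤n))))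
  where pos≤outdeg : count (λ v → arc D u v ∧ f v) ≤ count (arc D u)
        pos≤outdeg = count-mono {p = λ v → arc D u v ∧ f v} (λ v → ∧-elimˡ)

Closed : ∀ {n} → Digraph n → (Fin n → Bool) → Set
Closed D f = ∀ u v → f u ≡ true → arc D u v ≡ true → f v ≡ true

closed⇒count≤good : ∀ {n} (D : Digraph n) f → Closed D f → count f ≤ goodCount D f
closed⇒count≤good D f closed = count-mono λ u fu → good-if-closed D f u fu (λ v → closed u v fu)

outdeg≤1⇒good≤count : ∀ {n} (D : Digraph n) f → (∀ u → count (arc D u) ≤ 1) → goodCount D f ≤ count f
outdeg≤1⇒good≤count D f outdeg≤1 =
  count-mono λ u → contraposeᵇ (not-good-outdeg≤1 D f u (outdeg≤1 u))

weight-≥ : ∀ {n} (f : Fin n → Bool) {c} → c ≤ count f → (2 * c) ⊖ n ℤ.≤ weight f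
weight-≥ {n} f {c} c≤P = subst ((2 * c) ⊖ n ℤ.≤_) (≡-sym (weight≡ f))
                           (ℤₚ.⊖-monoˡ-≤ n (*-monoʳ-≤ 2 c≤P))

weight-≡ : ∀ {n} (f : Fin n → Bool) {c} → count f ≡ c → weight f ≡ (2 * c) ⊖ n
weight-≡ {n} f P≡c = trans (weight≡ f) (cong (λ P → (2 * P) ⊖ n) P≡c)

gamma-from-counts : ∀ {n} (D : Digraph n) c →
  (∀ f → IsMODF D f → c ≤ count f) → (∃ λ f → IsMODF D f × count f ≡ c) →
  IsGammaMaj D ((2 * c) ⊖ n)
gamma-from-counts D c least (f , modf , P≡c) =
  (f , modf , weight-≡ f P≡c) , λ g modf-g → weight-≥ g (least g modf-g)

dom-from-counts : ∀ {n} (G : Graph n) c →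
  (∀ D → IsOrientation G D → ∀ f → IsMODF D f → c ≤ count f) →
  (∃ λ D → IsOrientation G D × ∃ λ f → IsMODF D f × count f ≡ c) →
  IsDomMaj G ((2 * c) ⊖ n)
dom-from-counts G c least (D , orient , witness) =
  (D , orient , gamma-from-counts D c (least D orient) witness) ,
  λ { D′ orient′ j ((f , modf , wf≡j) , _) →
        subst (_ ℤ.≤_) wf≡j (weight-≥ f (least D′ orient′ f modf)) }

DOM-from-counts : ∀ {n} (G : Graph n) c →
  (∃ λ D → IsOrientation G D × (∀ f → IsMODF D f → c ≤ count f)) →
  (∀ D → IsOrientation G D → ∃ λ f → IsMODF D f × count f ≡ c) →
  IsDOMMaj G ((2 * c) ⊖ n)
DOM-from-counts G c (D , orient , least) witness =
  (D , orient , gamma-from-counts D c least (witness D orient)) ,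
  λ { D′ orient′ j (_ , j≤) → let (f , modf , P≡c) = witness D′ orient′ in
        subst (j ℤ.≤_) (weight-≡ f P≡c) (j≤ f modf) }

dom-from-bounds : ∀ {n} (G : Graph n) e c →
  (∀ D → IsOrientation G D → ∀ f → IsMODF D f → n ≤ 2 * (e + count f)) →
  (∃ λ D → IsOrientation G D × ∃ λ f → count f ≡ c × e + c ≤ goodCount D f) →
  n ≤ 2 * (e + c) → 2 * (e + c) ≤ suc n → IsDomMaj G ((2 * c) ⊖ n)
dom-from-bounds G e c bound (D , orient , f , P≡c , e+c≤good) n≤2[e+c] 2[e+c]≤1+n =
  dom-from-counts G c
    (λ D′ orient′ g modf → +-cancelˡ-≤ e c (count g)
       (halve (≤-trans 2[e+c]≤1+n (s≤s (bound D′ orient′ g modf)))))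
    (D , orient , f , ≤-trans n≤2[e+c] (*-monoʳ-≤ 2 e+c≤good) , P≡c)

relabel : ∀ {n} → (Fin n → Fin n) → Digraph n → Digraph n
relabel σ D = record { arc = λ u v → arc D (σ u) (σ v) ; noLoop = λ u → noLoop D (σ u) }

orientation-relabel : ∀ {n} (H G : Graph n) (σ : Fin n → Fin n) →
  (∀ u v → adj H u v ≡ adj G (σ u) (σ v)) →
  ∀ D → IsOrientation G D → IsOrientation H (relabel σ D)
orientation-relabel H G σ adj≡ D (arc⇒adj , oneWay) =
  (λ u v uv → trans (adj≡ u v) (arc⇒adj (σ u) (σ v) uv)) ,
  (λ u v uv → oneWay (σ u) (σ v) (trans (≡-sym (adj≡ u v)) uv))

module DigraphIso {n} (ψ : Fin n ↔ Fin n) (D D′ : Digraph n)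
  (arc≡ : ∀ u v → arc D u v ≡ arc D′ (Inverse.to ψ u) (Inverse.to ψ v)) where
  open Inverse ψ using (to; from; strictlyInverseʳ)

  count-along : (p p′ : Fin n → Bool) → (∀ u → p u ≡ p′ (to u)) → count p ≡ count p′
  count-along p p′ p≡ = trans (count-ext p≡) (≡-sym (count-permute ψ p′))

  module _ (f f′ : Fin n → Bool) (f≡ : ∀ u → f u ≡ f′ (to u)) where
    good-along : ∀ u → good D f u ≡ good D′ f′ (to u)
    good-along u = trans (good≡ D f u) (trans (cong₂ _<ᵇ_ neg≡ pos≡) (≡-sym (good≡ D′ f′ (to u))))
      where pos≡ = cong₂ _+_ (cong 𝟙 (f≡ u))
                     (count-along _ _ λ v → cong₂ _∧_ (arc≡ u v) (f≡ v))
            neg≡ = cong₂ _+_ (cong (𝟙 ∘ not) (f≡ u))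
                     (count-along _ _ λ v → cong₂ _∧_ (arc≡ u v) (cong not (f≡ v)))

    modf-along : IsMODF D f → IsMODF D′ f′
    modf-along modf = subst (λ g → n ≤ 2 * g) (count-along _ _ good-along) modf

    modf-back : IsMODF D′ f′ → IsMODF D f
    modf-back modf′ = subst (λ g → n ≤ 2 * g) (≡-sym (count-along _ _ good-along)) modf′

    weight-along : weight f ≡ weight f′
    weight-along = trans (weight≡ f) (trans (cong (λ P → (2 * P) ⊖ n) (count-along f f′ f≡))
                                            (≡-sym (weight≡ f′)))

  private
    pushed : ∀ (f : Fin n → Bool) u → f u ≡ f (from (to u))
    pushed f u = cong f (≡-sym (strictlyInverseʳ u))

  gamma-along : ∀ {k} → IsGammaMaj D k → IsGammaMaj D′ k
  gamma-along {k} ((f , modf , wf) , least) =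
    (f ∘ from , modf-along f (f ∘ from) (pushed f) modf , trans (≡-sym (weight-along f (f ∘ from) (pushed f))) wf) ,
    λ f′ modf′ → subst (k ℤ.≤_) (weight-along (f′ ∘ to) f′ (λ _ → refl))
                       (least (f′ ∘ to) (modf-back (f′ ∘ to) f′ (λ _ → refl) modf′))

  gamma-back : ∀ {k} → IsGammaMaj D′ k → IsGammaMaj D k
  gamma-back {k} ((f′ , modf′ , wf′) , least′) =
    (f′ ∘ to , modf-back (f′ ∘ to) f′ (λ _ → refl) modf′ , trans (weight-along (f′ ∘ to) f′ (λ _ → refl)) wf′) ,
    λ f modf → subst (k ℤ.≤_) (≡-sym (weight-along f (f ∘ from) (pushed f)))
                     (least′ (f ∘ from) (modf-along f (f ∘ from) (pushed f) modf))

module GraphIso {n} (G S : Graph n) (φ : Fin n ↔ Fin n)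
  (adj≡ : ∀ u v → adj G u v ≡ adj S (Inverse.to φ u) (Inverse.to φ v)) where
  open Inverse φ using (to; from; strictlyInverseˡ; strictlyInverseʳ)

  private
    adj≡′ : ∀ x y → adj S x y ≡ adj G (from x) (from y)
    adj≡′ x y = ≡-sym (trans (adj≡ (from x) (from y))
                             (cong₂ (adj S) (strictlyInverseˡ x) (strictlyInverseˡ y)))

    toG-orientation : ∀ D′ → IsOrientation S D′ → IsOrientation G (relabel to D′)
    toG-orientation = orientation-relabel G S to adj≡

    toG-gamma : ∀ D′ {k} → IsGammaMaj D′ k → IsGammaMaj (relabel to D′) k
    toG-gamma D′ = DigraphIso.gamma-back φ (relabel to D′) D′ (λ _ _ → refl)

    toS-orientation : ∀ D → IsOrientation G D → IsOrientation S (relabel from D)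
    toS-orientation = orientation-relabel S G from adj≡′

    toS-gamma : ∀ D {k} → IsGammaMaj D k → IsGammaMaj (relabel from D) k
    toS-gamma D = DigraphIso.gamma-along φ D (relabel from D)
      (λ u v → cong₂ (arc D) (≡-sym (strictlyInverseʳ u)) (≡-sym (strictlyInverseʳ v)))

  dom-transfer : ∀ {k} → IsDomMaj S k → IsDomMaj G k
  dom-transfer ((D′ , orient , γ) , least) =
    (relabel to D′ , toG-orientation D′ orient , toG-gamma D′ γ) ,
    λ D orient-D j γj → least (relabel from D) (toS-orientation D orient-D) j (toS-gamma D γj)

  DOM-transfer : ∀ {k} → IsDOMMaj S k → IsDOMMaj G k
  DOM-transfer ((D′ , orient , γ) , greatest) =
    (relabel to D′ , toG-orientation D′ orient , toG-gamma D′ γ) ,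
    λ D orient-D j γj → greatest (relabel from D) (toS-orientation D orient-D) j (toS-gamma D γj)

  deg-transfer : ∀ v → deg G v ≡ deg S (to v)
  deg-transfer v = trans (count-ext (adj≡ v)) (≡-sym (count-permute φ (adj S (to v))))

module DoubleStar (a b : ℕ) where

  N : ℕ
  N = 2 + a + b

  S : Graph N
  S = doubleStar a b

  X Y : Fin N
  X = fz
  Y = fs fz

  L : Fin (a + b) → Fin N
  L k = fs (fs k)

  side : Fin (a + b) → Bool
  side k = toℕ k <ᵇ a

  count-side : count side ≡ a
  count-side = trans (count-below (a + b) a) (m≤n⇒m⊓n≡m (m≤m+n a b))

  count-¬side : count (not ∘ side) ≡ b
  count-¬side = +-cancelˡ-≡ a _ _
    (trans (cong (_+ count (not ∘ side)) (≡-sym count-side)) (count-complement side))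

  adj-XL : ∀ k → adj S X (L k) ≡ side k
  adj-XL k with side k
  ... | true  = refl
  ... | false = refl

  adj-YL : ∀ k → adj S Y (L k) ≡ not (side k)
  adj-YL k with side k
  ... | true  = refl
  ... | false = refl

  adj-LX : ∀ k → adj S (L k) X ≡ side k
  adj-LX k = trans (Graph.sym S (L k) X) (adj-XL k)

  adj-LY : ∀ k → adj S (L k) Y ≡ not (side k)
  adj-LY k = trans (Graph.sym S (L k) Y) (adj-YL k)

  adj-LL : ∀ k k′ → adj S (L k) (L k′) ≡ false
  adj-LL k k′ with side k | side k′
  ... | true  | true  = refl
  ... | true  | false = refl
  ... | false | true  = refl
  ... | false | false = refl

  deg-X : deg S X ≡ suc a
  deg-X = cong suc (trans (count-ext adj-XL) count-side)

  deg-Y : deg S Y ≡ suc b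
  deg-Y = cong suc (trans (count-ext adj-YL) count-¬side)

  deg-L : ∀ k → deg S (L k) ≡ 1
  deg-L k = begin
    deg S (L k)                                            ≡⟨⟩
    𝟙 (adj S (L k) X) + (𝟙 (adj S (L k) Y) + count (λ k′ → adj S (L k) (L k′)))
      ≡⟨ cong₂ (λ x y → 𝟙 x + (𝟙 y + count (λ k′ → adj S (L k) (L k′)))) (adj-LX k) (adj-LY k) ⟩
    𝟙 (side k) + (𝟙 (not (side k)) + count (λ k′ → adj S (L k) (L k′)))
      ≡⟨ cong (λ z → 𝟙 (side k) + (𝟙 (not (side k)) + z)) (count-none (adj-LL k)) ⟩
    𝟙 (side k) + (𝟙 (not (side k)) + 0)                   ≡⟨ one-side (side k) ⟩
    1                                                      ∎
    where open ≡-Reasoning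
          one-side : ∀ s → 𝟙 s + (𝟙 (not s) + 0) ≡ 1
          one-side true  = refl
          one-side false = refl

  count-leaves : (p : Fin N → Bool) → p X ≡ false → p Y ≡ false → count p ≡ count (p ∘ L)
  count-leaves p pX pY rewrite pX | pY = refl

  module Oriented (D : Digraph N) (orient : IsOrientation S D) where

    arc-nonadj : ∀ u v → adj S u v ≡ false → arc D u v ≡ false
    arc-nonadj u v uv with arc D u v in e
    ... | false = refl
    ... | true  = trans (≡-sym (proj₁ orient u v e)) uv

    arc-reverse : ∀ u v → adj S u v ≡ true → arc D v u ≡ not (arc D u v)
    arc-reverse u v uv with proj₂ orient u v uv
    ... | inj₁ (u→v , v↛u) rewrite u→v = v↛u
    ... | inj₂ (u↛v , v→u) rewrite u↛v = v→u

    out-X out-Y : Fin (a + b) → Bool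
    out-X k = arc D X (L k)
    out-Y k = arc D Y (L k)

    sink : Fin (a + b) → Bool
    sink k = out-X k ∨ out-Y k

    out-X⇒side : ∀ k → out-X k ≡ true → side k ≡ true
    out-X⇒side k x→k = trans (≡-sym (adj-XL k)) (proj₁ orient X (L k) x→k)

    out-Y⇒¬side : ∀ k → out-Y k ≡ true → side k ≡ false
    out-Y⇒¬side k y→k = not-true (trans (≡-sym (adj-YL k)) (proj₁ orient Y (L k) y→k))

    arc-YX : arc D Y X ≡ not (arc D X Y)
    arc-YX = arc-reverse X Y refl

    leaf-leaf : ∀ k k′ → arc D (L k) (L k′) ≡ false
    leaf-leaf k k′ = arc-nonadj (L k) (L k′) (adj-LL k k′)

    leaf-outdeg : ∀ k → count (arc D (L k)) ≤ 1
    leaf-outdeg k = ≤-trans (count-mono (proj₁ orient (L k))) (≤-reflexive (deg-L k))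

    sink-no-out : ∀ k → sink k ≡ true → ∀ v → arc D (L k) v ≡ false
    sink-no-out k sk fz with ∨-cases sk
    ... | inj₁ x→k = trans (arc-reverse X (L k) (trans (adj-XL k) (out-X⇒side k x→k))) (cong not x→k)
    ... | inj₂ y→k = arc-nonadj (L k) X (trans (adj-LX k) (out-Y⇒¬side k y→k))
    sink-no-out k sk (fs fz) with ∨-cases sk
    ... | inj₁ x→k = arc-nonadj (L k) Y (trans (adj-LY k) (cong not (out-X⇒side k x→k)))
    ... | inj₂ y→k = trans (arc-reverse Y (L k) (trans (adj-YL k) (cong not (out-Y⇒¬side k y→k))))
                           (cong not y→k)
    sink-no-out k sk (fs (fs k′)) = leaf-leaf k k′

    -- only + leaves are good (a leaf sees at most one vertex besides itself)
    good-leaf⇒+ : ∀ f k → good D f (L k) ≡ true → f (L k) ≡ true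
    good-leaf⇒+ f k = contraposeᵇ (not-good-outdeg≤1 D f (L k) (leaf-outdeg k))

    good-leaves≤ : ∀ f → count (good D f ∘ L) ≤ count (f ∘ L)
    good-leaves≤ f = count-mono (good-leaf⇒+ f)

    -- only the two stems can be good without being +
    good≤2+ : ∀ f → goodCount D f ≤ 2 + count f
    good≤2+ f = +-mono-≤ (𝟙≤1 (good D f X)) (+-mono-≤ (𝟙≤1 (good D f Y))
                  (≤-trans (good-leaves≤ f) (≤-trans (m≤n+m (count (f ∘ L)) (𝟙 (f Y)))
                                                     (m≤n+m _ (𝟙 (f X))))))

    negative-stem : ∀ f s t → f X ≡ false → f Y ≡ false → f s ≡ false → f t ≡ false →
                    good D f s ≡ true → 2 + 𝟙 (arc D s t) ≤ count (λ k → arc D s (L k) ∧ f (L k))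
    negative-stem f s t fX fY s− t− gs = begin
      2 + 𝟙 (arc D s t)                        ≡⟨ cong (λ x → 2 + 𝟙 x) (≡-sym s→t−) ⟩
      2 + 𝟙 (arc D s t ∧ not (f t))            ≤⟨ s≤s (s≤s (𝟙≤count (λ v → arc D s v ∧ not (f v)) t)) ⟩
      2 + count (λ v → arc D s v ∧ not (f v))  ≤⟨ <ᵇ⇒<′ (trans (≡-sym (good-negative D f s s−)) gs) ⟩
      count (λ v → arc D s v ∧ f v)            ≡⟨ count-leaves (λ v → arc D s v ∧ f v) (off fX) (off fY) ⟩
      count (λ k → arc D s (L k) ∧ f (L k))    ∎
      where open ≤-Reasoning
            s→t− : arc D s t ∧ not (f t) ≡ arc D s t
            s→t− = trans (cong (λ x → arc D s t ∧ not x) t−) (∧-identityʳ _)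
            off : ∀ {w} → f w ≡ false → arc D s w ∧ f w ≡ false
            off {w} fw = trans (cong (arc D s w ∧_) fw) (∧-zeroʳ _)

    out-leaves≤ : ∀ (f : Fin N → Bool) → count (λ k → out-X k ∧ f (L k)) + count (λ k → out-Y k ∧ f (L k)) ≤ count (f ∘ L)
    out-leaves≤ f = ≤-trans (≤-reflexive (≡-sym (count-∨ (λ k → out-X k ∧ f (L k)) (λ k → out-Y k ∧ f (L k)) disjoint)))
                            (count-mono {p = λ k → (out-X k ∧ f (L k)) ∨ (out-Y k ∧ f (L k))} {q = f ∘ L}
                                        λ k h → [ ∧-elimʳ {out-X k} , ∧-elimʳ {out-Y k} ]′ (∨-cases h))
      where disjoint : ∀ k → (out-X k ∧ f (L k)) ∧ (out-Y k ∧ f (L k)) ≡ false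
            disjoint k with out-X k in x→k | out-Y k in y→k
            ... | false | _     = refl
            ... | true  | false = ∧-zeroʳ _
            ... | true  | true  =
              contradiction (trans (≡-sym (out-X⇒side k x→k)) (out-Y⇒¬side k y→k)) λ ()

    out-X-leaves≤a : ∀ (f : Fin N → Bool) → count (λ k → out-X k ∧ f (L k)) ≤ a
    out-X-leaves≤a f = ≤-trans (count-mono λ k h → out-X⇒side k (∧-elimˡ h)) (≤-reflexive count-side)

    out-Y-leaves≤b : ∀ (f : Fin N → Bool) → count (λ k → out-Y k ∧ f (L k)) ≤ b
    out-Y-leaves≤b f = ≤-trans (count-mono λ k h → cong not (out-Y⇒¬side k (∧-elimˡ h)))
                               (≤-reflexive count-¬side)

    saturated-stems : ∀ (f : Fin N → Bool) → 2 + count f ≤ goodCount D f →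
                      f X ≡ false × f Y ≡ false × good D f X ≡ true × good D f Y ≡ true
    saturated-stems f 2+P≤good = indicators-forced (f X) (f Y) (good D f X) (good D f Y)
      (+-cancelʳ-≤ PL _ _ (begin
        2 + (𝟙 (f X) + 𝟙 (f Y)) + PL   ≡⟨ cong (λ z → 2 + z) (+-assoc (𝟙 (f X)) _ PL) ⟩
        2 + count f                    ≤⟨ 2+P≤good ⟩
        goodCount D f                  ≤⟨ +-monoʳ-≤ (𝟙 (good D f X)) (+-monoʳ-≤ _ (good-leaves≤ f)) ⟩
        𝟙 (good D f X) + (𝟙 (good D f Y) + PL)
                                       ≡⟨ ≡-sym (+-assoc (𝟙 (good D f X)) _ PL) ⟩
        𝟙 (good D f X) + 𝟙 (good D f Y) + PL ∎))
      where open ≤-Reasoning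
            PL = count (f ∘ L)

    -- ... and then each stem sees at least two + leaves, five in total
    saturated : ∀ (f : Fin N → Bool) → 2 + count f ≤ goodCount D f → 5 ≤ count (f ∘ L) × 2 ≤ a × 2 ≤ b
    saturated f 2+P≤good with saturated-stems f 2+P≤good
    ... | X− , Y− , good-X , good-Y =
      ≤-trans (five (arc D X Y)) (≤-trans (+-mono-≤ pX≥ pY≥) (out-leaves≤ f)) ,
      ≤-trans (m≤m+n 2 _) (≤-trans pX≥ (out-X-leaves≤a f)) ,
      ≤-trans (m≤m+n 2 _) (≤-trans pY≥ (out-Y-leaves≤b f))
      where
      pX≥ : 2 + 𝟙 (arc D X Y) ≤ count (λ k → out-X k ∧ f (L k))
      pX≥ = negative-stem f X Y X− Y− X− Y− good-X
      pY≥ : 2 + 𝟙 (not (arc D X Y)) ≤ count (λ k → out-Y k ∧ f (L k))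
      pY≥ = subst (λ d → 2 + 𝟙 d ≤ count (λ k → out-Y k ∧ f (L k))) arc-YX
                  (negative-stem f Y X X− Y− Y− X− good-Y)
      five : ∀ d → 5 ≤ (2 + 𝟙 d) + (2 + 𝟙 (not d))
      five true  = ≤-refl
      five false = ≤-refl

    -- Every number c ≤ N of + vertices is realised by a closed labelling, one
    -- whose + vertices are closed under out-arcs, so that they are all good.

    sinks : ℕ
    sinks = count sink

    out-X⇒sink : ∀ k → out-X k ≡ true → sink k ≡ true
    out-X⇒sink k x→k = cong (_∨ out-Y k) x→k

    out-Y⇒sink : ∀ k → out-Y k ≡ true → sink k ≡ true
    out-Y⇒sink k y→k = trans (cong (out-X k ∨_) y→k) (∨-zeroʳ _)

    -- c ≤ sinks: c sink leaves are +
    few : ℕ → Fin N → Bool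
    few c fz          = false
    few c (fs fz)     = false
    few c (fs (fs k)) = take sink c k

    few-closed : ∀ c → Closed D (few c)
    few-closed c (fs (fs k)) v +k k→v =
      contradiction (trans (≡-sym k→v) (sink-no-out k (take-⊆ sink c k +k) v)) λ ()

    -- c = sinks + 1: the sink leaves and the head of the stem arc are +
    headed : Fin N → Bool
    headed fz          = not (arc D X Y)
    headed (fs fz)     = arc D X Y
    headed (fs (fs k)) = sink k

    headed-closed : Closed D headed
    headed-closed fz          fz          _  X→X = contradiction (trans (≡-sym X→X) (noLoop D X)) λ ()
    headed-closed fz          (fs fz)     +X X→Y = contradiction (trans (≡-sym (cong not X→Y)) +X) λ ()
    headed-closed fz          (fs (fs k)) _  X→k = out-X⇒sink k X→k
    headed-closed (fs fz)     fz          +Y Y→X =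
      contradiction (trans (≡-sym Y→X) (trans arc-YX (cong not +Y))) λ ()
    headed-closed (fs fz)     (fs fz)     _  Y→Y = contradiction (trans (≡-sym Y→Y) (noLoop D Y)) λ ()
    headed-closed (fs fz)     (fs (fs k)) _  Y→k = out-Y⇒sink k Y→k
    headed-closed (fs (fs k)) v           +k k→v =
      contradiction (trans (≡-sym k→v) (sink-no-out k +k v)) λ ()

    count-headed : count headed ≡ suc sinks
    count-headed with arc D X Y
    ... | true  = refl
    ... | false = refl

    -- c ≥ sinks + 2: both stems, all sink leaves and r further leaves are +
    many : ℕ → Fin N → Bool
    many r fz          = true
    many r (fs fz)     = true
    many r (fs (fs k)) = sink k ∨ take (not ∘ sink) r k

    many-closed : ∀ r → Closed D (many r)
    many-closed r fz          fz          _ _   = refl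
    many-closed r fz          (fs fz)     _ _   = refl
    many-closed r fz          (fs (fs k)) _ X→k = cong (_∨ take (not ∘ sink) r k) (out-X⇒sink k X→k)
    many-closed r (fs fz)     fz          _ _   = refl
    many-closed r (fs fz)     (fs fz)     _ _   = refl
    many-closed r (fs fz)     (fs (fs k)) _ Y→k = cong (_∨ take (not ∘ sink) r k) (out-Y⇒sink k Y→k)
    many-closed r (fs (fs k)) fz          _ _   = refl
    many-closed r (fs (fs k)) (fs fz)     _ _   = refl
    many-closed r (fs (fs k)) (fs (fs j)) _ k→j =
      contradiction (trans (≡-sym k→j) (leaf-leaf k j)) λ ()

    count-many : ∀ r → r ≤ count (not ∘ sink) → count (many r) ≡ 2 + (sinks + r)
    count-many r r≤ = cong (λ z → 2 + z)
      (trans (count-∨ sink (take (not ∘ sink) r) disjoint)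
             (cong (λ z → sinks + z) (take-count-≤ (not ∘ sink) r≤)))
      where disjoint : ∀ k → sink k ∧ take (not ∘ sink) r k ≡ false
            disjoint k with take (not ∘ sink) r k in taken
            ... | false = ∧-zeroʳ _
            ... | true  = trans (∧-identityʳ _) (not-true (take-⊆ (not ∘ sink) r k taken))

    closed-labelling : ∀ c → c ≤ N → ∃ λ f → Closed D f × count f ≡ c
    closed-labelling c c≤N with c ≤? sinks
    ... | yes c≤s = few c , few-closed c , take-count-≤ sink c≤s
    ... | no  c≰s with c ≟ suc sinks
    ...   | yes c≡ = headed , headed-closed , trans count-headed (≡-sym c≡)
    ...   | no  c≢ = many r , many-closed r , trans (count-many r r≤) c≡
      where
      2+s≤c : 2 + sinks ≤ c
      2+s≤c = ≤∧≢⇒< (≰⇒> c≰s) (c≢ ∘ ≡-sym)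
      r = c ∸ (2 + sinks)
      c≡ : 2 + (sinks + r) ≡ c
      c≡ = m+[n∸m]≡n 2+s≤c
      r≤ : r ≤ count (not ∘ sink)
      r≤ = +-cancelˡ-≤ (2 + sinks) r _
             (subst (λ m → 2 + sinks + r ≤ 2 + m) (≡-sym (count-complement sink))
                    (subst (_≤ N) (≡-sym c≡) c≤N))

    balanced-modf : ∀ c → N ≤ 2 * c → 2 * c ≤ suc N → ∃ λ f → IsMODF D f × count f ≡ c
    balanced-modf c N≤2c 2c≤1+N with closed-labelling c c≤N
      where c≤N = halve (≤-trans 2c≤1+N (s≤s (m≤m+n N (N + 0))))
    ... | f , closed , P≡c =
      f , ≤-trans N≤2c (*-monoʳ-≤ 2
                           (subst (_≤ goodCount D f) P≡c (closed⇒count≤good D f closed))) , P≡c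

  -- Fan orientations.  The stem arc points X → Y iff d; leaf k is an
  -- out-neighbour of its stem iff `out k`, and points to its stem otherwise.
  fanArc : Bool → (Fin (a + b) → Bool) → Fin N → Fin N → Bool
  fanArc d out fz          fz           = false
  fanArc d out fz          (fs fz)      = d
  fanArc d out fz          (fs (fs k))  = side k ∧ out k
  fanArc d out (fs fz)     fz           = not d
  fanArc d out (fs fz)     (fs fz)      = false
  fanArc d out (fs fz)     (fs (fs k))  = not (side k) ∧ out k
  fanArc d out (fs (fs k)) fz           = side k ∧ not (out k)
  fanArc d out (fs (fs k)) (fs fz)      = not (side k) ∧ not (out k)
  fanArc d out (fs (fs k)) (fs (fs k′)) = false

  fan : Bool → (Fin (a + b) → Bool) → Digraph N
  fan d out = record { arc = fanArc d out ; noLoop = noLoop′ }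
    where noLoop′ : ∀ u → fanArc d out u u ≡ false
          noLoop′ fz          = refl
          noLoop′ (fs fz)     = refl
          noLoop′ (fs (fs k)) = refl

  fan-orientation : ∀ d out → IsOrientation S (fan d out)
  fan-orientation d out = arc⇒adj , one-way
    where
    arc⇒adj : ∀ u v → fanArc d out u v ≡ true → adj S u v ≡ true
    arc⇒adj fz          (fs fz)     _  = refl
    arc⇒adj fz          (fs (fs k)) uv = trans (adj-XL k) (∧-elimˡ uv)
    arc⇒adj (fs fz)     fz          _  = refl
    arc⇒adj (fs fz)     (fs (fs k)) uv = trans (adj-YL k) (∧-elimˡ uv)
    arc⇒adj (fs (fs k)) fz          uv = trans (adj-LX k) (∧-elimˡ uv)
    arc⇒adj (fs (fs k)) (fs fz)     uv = trans (adj-LY k) (∧-elimˡ uv)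

    OneWay : Bool → Bool → Set
    OneWay x y = (x ≡ true × y ≡ false) ⊎ (x ≡ false × y ≡ true)

    opposite : ∀ x → OneWay x (not x)
    opposite true  = inj₁ (refl , refl)
    opposite false = inj₂ (refl , refl)

    opposite′ : ∀ x → OneWay (not x) x
    opposite′ true  = inj₂ (refl , refl)
    opposite′ false = inj₁ (refl , refl)

    one-way : ∀ u v → adj S u v ≡ true → OneWay (fanArc d out u v) (fanArc d out v u)
    one-way fz          (fs fz)     _  = opposite d
    one-way (fs fz)     fz          _  = opposite′ d
    one-way fz (fs (fs k)) uv rewrite trans (≡-sym (adj-XL k)) uv = opposite (out k)
    one-way (fs (fs k)) fz uv rewrite trans (≡-sym (adj-LX k)) uv = opposite′ (out k)
    one-way (fs fz) (fs (fs k)) uv rewrite not-true (trans (≡-sym (adj-YL k)) uv) = opposite (out k)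
    one-way (fs (fs k)) (fs fz) uv rewrite not-true (trans (≡-sym (adj-LY k)) uv) = opposite′ (out k)
    one-way (fs (fs k)) (fs (fs k′)) uv = contradiction (trans (≡-sym uv) (adj-LL k k′)) λ ()

  -- In a fan, label exactly the out-leaves +.  These are sinks, hence good;
  -- a stem is good when it has at least two more + than − out-neighbours.
  fanLabel : (Fin (a + b) → Bool) → Fin N → Bool
  fanLabel out fz          = false
  fanLabel out (fs fz)     = false
  fanLabel out (fs (fs k)) = out k

  module Fan (d : Bool) (out : Fin (a + b) → Bool) where
    F : Digraph N
    F = fan d out

    f : Fin N → Bool
    f = fanLabel out

    open Oriented F (fan-orientation d out) using (sink; sink-no-out)

    out⇒sink : ∀ k → out k ≡ true → sink k ≡ true
    out⇒sink k +k rewrite +k with side k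
    ... | true  = refl
    ... | false = refl

    good-leaves : count out ≤ count (good F f ∘ L)
    good-leaves = count-mono λ k +k → good-if-closed F f (L k) +k λ v k→v →
      contradiction (trans (≡-sym k→v) (sink-no-out k (out⇒sink k +k) v)) λ ()

    good≥ : 𝟙 (good F f X) + (𝟙 (good F f Y) + count out) ≤ goodCount F f
    good≥ = +-monoʳ-≤ (𝟙 (good F f X)) (+-monoʳ-≤ (𝟙 (good F f Y)) good-leaves)

    good-X : 2 + 𝟙 d ≤ count (λ k → side k ∧ out k) → good F f X ≡ true
    good-X enough = good-if-negative F f X refl (subst₂ (λ m p → 2 + m ≤ p) (≡-sym neg) (≡-sym pos) enough)
      where
      neg : count (λ v → fanArc d out X v ∧ not (f v)) ≡ 𝟙 d
      neg = trans (cong₂ (λ x y → 𝟙 x + y) (∧-identityʳ d) (count-none (λ k → ∧-not (side k) (out k))))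
                  (+-identityʳ (𝟙 d))
      pos : count (λ v → fanArc d out X v ∧ f v) ≡ count (λ k → side k ∧ out k)
      pos = cong₂ (λ x y → 𝟙 x + y) (∧-zeroʳ d) (count-ext (λ k → ∧-dup (side k) (out k)))

    good-Y : 2 + 𝟙 (not d) ≤ count (λ k → not (side k) ∧ out k) → good F f Y ≡ true
    good-Y enough = good-if-negative F f Y refl (subst₂ (λ m p → 2 + m ≤ p) (≡-sym neg) (≡-sym pos) enough)
      where
      neg : count (λ v → fanArc d out Y v ∧ not (f v)) ≡ 𝟙 (not d)
      neg = trans (cong₂ (λ x y → 𝟙 x + y) (∧-identityʳ (not d)) (count-none (λ k → ∧-not (not (side k)) (out k))))
                  (+-identityʳ (𝟙 (not d)))
      pos : count (λ v → fanArc d out Y v ∧ f v) ≡ count (λ k → not (side k) ∧ out k)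
      pos = cong₂ (λ x y → 𝟙 x + y) (∧-zeroʳ (not d)) (count-ext (λ k → ∧-dup (not (side k)) (out k)))

  -- The inward fan: X → Y and every leaf points to its stem.  All out-degrees
  -- are at most 1, so only + vertices can be good.
  inward : Digraph N
  inward = fan true (λ _ → false)

  inward-outdeg : ∀ u → count (arc inward u) ≤ 1
  inward-outdeg fz          = ≤-reflexive (cong suc (count-none (λ k → ∧-zeroʳ (side k))))
  inward-outdeg (fs fz)     = ≤-trans (≤-reflexive (count-none (λ k → ∧-zeroʳ (not (side k))))) z≤n
  inward-outdeg (fs (fs k)) = Oriented.leaf-outdeg inward (fan-orientation true _) k

  fanOut : ℕ → ℕ → Fin (a + b) → Bool
  fanOut tX tY k = take side tX k ∨ take (not ∘ side) tY k

  module CountedFan (d : Bool) {tX tY} (tX≤a : tX ≤ a) (tY≤b : tY ≤ b) where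
    open Fan d (fanOut tX tY) public

    count-X : count (λ k → side k ∧ fanOut tX tY k) ≡ tX
    count-X = trans (count-ext λ k → ∧-∨-left (side k) _ _ (take-⊆ side tX k) (not-true ∘ take-⊆ (not ∘ side) tY k))
                    (take-count-≤ side (subst (tX ≤_) (≡-sym count-side) tX≤a))

    count-Y : count (λ k → not (side k) ∧ fanOut tX tY k) ≡ tY
    count-Y = trans (count-ext λ k → ∧-∨-right (side k) _ _ (take-⊆ side tX k) (not-true ∘ take-⊆ (not ∘ side) tY k))
                    (take-count-≤ (not ∘ side) (subst (tY ≤_) (≡-sym count-¬side) tY≤b))

    count-out : count (fanOut tX tY) ≡ tX + tY
    count-out = trans (count-∨ _ _ disjoint)
                      (cong₂ _+_ (take-count-≤ side (subst (tX ≤_) (≡-sym count-side) tX≤a))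
                                 (take-count-≤ (not ∘ side) (subst (tY ≤_) (≡-sym count-¬side) tY≤b)))
      where disjoint : ∀ k → take side tX k ∧ take (not ∘ side) tY k ≡ false
            disjoint k with take side tX k in x | take (not ∘ side) tY k in y
            ... | false | _     = refl
            ... | true  | false = refl
            ... | true  | true  = contradiction (trans (≡-sym (take-⊆ side tX k x))
                                                      (not-true (take-⊆ (not ∘ side) tY k y))) λ ()

  -- Witness e c: an orientation and a labelling with c + vertices and at least
  -- e + c good ones (e good − stems).
  Witness : ℕ → ℕ → Set
  Witness e c = ∃ λ D → IsOrientation S D × ∃ λ f → count f ≡ c × e + c ≤ goodCount D f

  module SizedFan (d : Bool) {c tX tY} (tX≤a : tX ≤ a) (tY≤b : tY ≤ b) (tX+tY≡c : tX + tY ≡ c) where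
    open CountedFan d tX≤a tY≤b public

    count-f : count f ≡ c
    count-f = trans count-out tX+tY≡c

    good≥′ : 𝟙 (good F f X) + (𝟙 (good F f Y) + c) ≤ goodCount F f
    good≥′ = subst (λ z → 𝟙 (good F f X) + (𝟙 (good F f Y) + z) ≤ goodCount F f) count-f good≥

  -- both stems good: at least 3 and 2 out-leaves, the stem arc leaving the first
  both-stems-witness : ∀ d {c} → 2 + 𝟙 d ≤ a → 2 + 𝟙 (not d) ≤ b →
                       (2 + 𝟙 d) + (2 + 𝟙 (not d)) ≤ c → c ≤ a + b → Witness 2 c
  both-stems-witness d {c} loX≤a loY≤b lo≤c c≤a+b with split-between loX≤a loY≤b lo≤c c≤a+b
  ... | tX , tY , loX≤tX , tX≤a , loY≤tY , tY≤b , tX+tY≡c =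
    F , fan-orientation d _ , f , count-f ,
    subst (_≤ goodCount F f) (cong₂ (λ x y → 𝟙 x + (𝟙 y + c)) good-X′ good-Y′) good≥′
    where open SizedFan d tX≤a tY≤b tX+tY≡c
          good-X′ = good-X (subst (2 + 𝟙 d ≤_) (≡-sym count-X) loX≤tX)
          good-Y′ = good-Y (subst (2 + 𝟙 (not d) ≤_) (≡-sym count-Y) loY≤tY)

  -- one stem good: X with two out-leaves and Y → X, or symmetrically
  X-stem-witness : ∀ {c} → 2 ≤ a → 2 ≤ c → c ≤ a + b → Witness 1 c
  X-stem-witness {c} 2≤a 2≤c c≤a+b with split-between 2≤a z≤n (subst (_≤ c) (≡-sym (+-identityʳ 2)) 2≤c) c≤a+b
  ... | tX , tY , 2≤tX , tX≤a , _ , tY≤b , tX+tY≡c =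
    F , fan-orientation false _ , f , count-f ,
    ≤-trans (≤-reflexive (cong (λ x → 𝟙 x + c) (≡-sym good-X′)))
            (≤-trans (+-monoʳ-≤ _ (m≤n+m c _)) good≥′)
    where open SizedFan false tX≤a tY≤b tX+tY≡c
          good-X′ = good-X (subst (2 ≤_) (≡-sym count-X) 2≤tX)

  Y-stem-witness : ∀ {c} → 2 ≤ b → 2 ≤ c → c ≤ a + b → Witness 1 c
  Y-stem-witness {c} 2≤b 2≤c c≤a+b with split-between z≤n 2≤b 2≤c c≤a+b
  ... | tX , tY , _ , tX≤a , 2≤tY , tY≤b , tX+tY≡c =
    F , fan-orientation true _ , f , count-f ,
    ≤-trans (≤-reflexive (cong (λ y → 𝟙 y + c) (≡-sym good-Y′)))
            (≤-trans (m≤n+m _ (𝟙 (good F f X))) good≥′)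
    where open SizedFan true tX≤a tY≤b tX+tY≡c
          good-Y′ = good-Y (subst (2 ≤_) (≡-sym count-Y) 2≤tY)

  -- at most two good vertices beyond the + ones
  modf-bound : ∀ D → IsOrientation S D → ∀ f → IsMODF D f → N ≤ 2 * (2 + count f)
  modf-bound D orient f modf = ≤-trans modf (*-monoʳ-≤ 2 (Oriented.good≤2+ D orient f))

  modf-bound-sharp : ¬ (13 ≤ N × 2 ≤ a × 2 ≤ b) →
                     ∀ D → IsOrientation S D → ∀ f → IsMODF D f → N ≤ 2 * (1 + count f)
  modf-bound-sharp excluded D orient f modf with N ≤? 2 * (1 + count f)
  ... | yes N≤ = N≤
  ... | no  N≰ = contradiction (13≤N , proj₂ saturated′) excluded
    where
    2[1+P]<N : 2 * (1 + count f) < N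
    2[1+P]<N = ≰⇒> N≰
    saturated′ = Oriented.saturated D orient f
                   (*-cancelˡ-< 2 (1 + count f) (goodCount D f) (≤-trans 2[1+P]<N modf))
    5≤P : 5 ≤ count f
    5≤P = ≤-trans (proj₁ saturated′) (≤-trans (m≤n+m _ (𝟙 (f Y))) (m≤n+m _ (𝟙 (f X))))
    13≤N : 13 ≤ N
    13≤N = ≤-trans (s≤s (*-monoʳ-≤ 2 (s≤s 5≤P))) 2[1+P]<N

  at-least : ∀ e l c → 2 * (e + l) ≤ suc N → N ≤ 2 * (e + c) → l ≤ c
  at-least e l c 2[e+l]≤1+N N≤2[e+c] =
    +-cancelˡ-≤ e l c (halve (≤-trans 2[e+l]≤1+N (s≤s N≤2[e+c])))

  at-most : ∀ e c → 2 * (suc e + c) ≤ suc N → c ≤ a + b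
  at-most e c 2[1+e+c]≤1+N = halve (≤-trans 2c≤1+a+b (s≤s (m≤m+n (a + b) _)))
    where 2c≤1+a+b : 2 * c ≤ suc (a + b)
          2c≤1+a+b = s≤s⁻¹ (s≤s⁻¹ (≤-trans (≤-reflexive (≡-sym (*-suc 2 c)))
                       (≤-trans (*-monoʳ-≤ 2 (s≤s (m≤n+m c e))) 2[1+e+c]≤1+N)))

  -- DOM⁺_maj(S) = 2k − N for N ≤ 2k ≤ N + 1, attained by the inward fan
  DOM-S : ∀ k → N ≤ 2 * k → 2 * k ≤ suc N → IsDOMMaj S ((2 * k) ⊖ N)
  DOM-S k N≤2k 2k≤1+N = DOM-from-counts S k
    (inward , fan-orientation true _ , λ f modf →
       halve (≤-trans 2k≤1+N (s≤s (≤-trans modf (*-monoʳ-≤ 2 (outdeg≤1⇒good≤count inward f inward-outdeg))))))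
    (λ D orient → Oriented.balanced-modf D orient k N≤2k 2k≤1+N)

  dom-S-two : 13 ≤ N → 2 ≤ a → 2 ≤ b → ∀ c → N ≤ 2 * (2 + c) → 2 * (2 + c) ≤ suc N →
              IsDomMaj S ((2 * c) ⊖ N)
  dom-S-two 13≤N 2≤a 2≤b c lo hi = dom-from-bounds S 2 c modf-bound witness lo hi
    where
    5≤c = at-least 2 5 c (s≤s 13≤N) lo
    c≤a+b = at-most 1 c hi
    witness : Witness 2 c
    witness with 3 ≤? a
    ... | yes 3≤a = both-stems-witness true  3≤a 2≤b 5≤c c≤a+b
    ... | no  3≰a = both-stems-witness false 2≤a 3≤b 5≤c c≤a+b
      where 3≤b = +-cancelˡ-≤ 2 3 b
                    (≤-trans (≤-trans 5≤c c≤a+b) (+-monoˡ-≤ b (s≤s⁻¹ (≰⇒> 3≰a))))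

  dom-S-one : 5 ≤ N → ¬ (13 ≤ N × 2 ≤ a × 2 ≤ b) → ∀ c → N ≤ 2 * (1 + c) → 2 * (1 + c) ≤ suc N →
              IsDomMaj S ((2 * c) ⊖ N)
  dom-S-one 5≤N excluded c lo hi = dom-from-bounds S 1 c (modf-bound-sharp excluded) witness lo hi
    where
    2≤c = at-least 1 2 c (s≤s 5≤N) lo
    c≤a+b = at-most 0 c hi
    witness : Witness 1 c
    witness with 2 ≤? a
    ... | yes 2≤a = X-stem-witness 2≤a 2≤c c≤a+b
    ... | no  2≰a = Y-stem-witness 2≤b 2≤c c≤a+b
      where 2≤b = +-cancelˡ-≤ 1 2 b
                    (≤-trans (s≤s⁻¹ (s≤s⁻¹ 5≤N)) (+-monoˡ-≤ b (s≤s⁻¹ (≰⇒> 2≰a))))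

  deg≡2 : ∀ u → deg S u ≡ 2 → a ≡ 1 ⊎ b ≡ 1
  deg≡2 fz          d≡2 = inj₁ (suc-injective (trans (≡-sym deg-X) d≡2))
  deg≡2 (fs fz)     d≡2 = inj₂ (suc-injective (trans (≡-sym deg-Y) d≡2))
  deg≡2 (fs (fs k)) d≡2 = contradiction (trans (≡-sym (deg-L k)) d≡2) λ ()

  -- The values by parity.  Write N + r = 2h with r ∈ {0, 1}.

  DOM-value : ∀ r {h} → r ≤ 1 → N + r ≡ 2 * h → IsDOMMaj S (+ r)
  DOM-value r {h} r≤1 N+r≡2h = subst (IsDOMMaj S) value (DOM-S h lo hi)
    where
    lo : N ≤ 2 * h
    lo = subst (N ≤_) N+r≡2h (m≤m+n N r)
    hi : 2 * h ≤ suc N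
    hi = subst (_≤ suc N) N+r≡2h (≤-trans (+-monoʳ-≤ N r≤1) (≤-reflexive (+-comm N 1)))
    value : (2 * h) ⊖ N ≡ + r
    value = trans (cong (_⊖ N) (≡-sym N+r≡2h)) (⊖-above N r)

  -- with e good − stems the value is −(2e − r) = −(1 + t)
  dom-value : ∀ e r t {h} →
              (∀ c → N ≤ 2 * (e + c) → 2 * (e + c) ≤ suc N → IsDomMaj S ((2 * c) ⊖ N)) →
              2 * e ≤ N → r ≤ 1 → N + r ≡ 2 * h → 2 * e ≡ r + suc t → IsDomMaj S -[1+ t ]
  dom-value e r t {h} dom 2e≤N r≤1 N+r≡2h 2e≡r+1+t with m≤n⇒∃[o]m+o≡n e≤h
    where e≤h : e ≤ h
          e≤h = halve (≤-trans 2e≤N (≤-trans (m≤m+n N r)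
                        (≤-trans (≤-reflexive N+r≡2h) (n≤1+n (2 * h)))))
  ... | c , e+c≡h = subst (IsDomMaj S) value (dom c lo hi)
    where
    N+r≡2[e+c] : N + r ≡ 2 * (e + c)
    N+r≡2[e+c] = trans N+r≡2h (cong (λ m → 2 * m) (≡-sym e+c≡h))
    lo : N ≤ 2 * (e + c)
    lo = subst (N ≤_) N+r≡2[e+c] (m≤m+n N r)
    hi : 2 * (e + c) ≤ suc N
    hi = subst (_≤ suc N) N+r≡2[e+c] (≤-trans (+-monoʳ-≤ N r≤1) (≤-reflexive (+-comm N 1)))
    N≡ : N ≡ 2 * c + suc t
    N≡ = trans (+-cancelˡ-≡ r N (suc t + 2 * c) (begin
      r + N                  ≡⟨ +-comm r N ⟩
      N + r                  ≡⟨ N+r≡2[e+c] ⟩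
      2 * (e + c)            ≡⟨ *-distribˡ-+ 2 e c ⟩
      2 * e + 2 * c          ≡⟨ cong (λ m → m + 2 * c) 2e≡r+1+t ⟩
      r + suc t + 2 * c      ≡⟨ +-assoc r (suc t) (2 * c) ⟩
      r + (suc t + 2 * c)    ∎)) (+-comm (suc t) (2 * c))
      where open ≡-Reasoning
    value : (2 * c) ⊖ N ≡ -[1+ t ]
    value = trans (cong ((2 * c) ⊖_) N≡) (⊖-below (2 * c) t)

  DOM-parity : (N % 2 ≡ 0 → IsDOMMaj S (+ 0)) × (N % 2 ≡ 1 → IsDOMMaj S (+ 1))
  DOM-parity = (λ even → DOM-value 0 {N / 2} z≤n (even-half N even)) ,
               (λ odd  → DOM-value 1 {suc (N / 2)} ≤-refl (odd-half N odd))

  dom-parity-two : 13 ≤ N → 2 ≤ a → 2 ≤ b →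
                   (N % 2 ≡ 0 → IsDomMaj S -[1+ 3 ]) × (N % 2 ≡ 1 → IsDomMaj S -[1+ 2 ])
  dom-parity-two 13≤N 2≤a 2≤b =
    (λ even → dom-value 2 0 3 {N / 2} (dom-S-two 13≤N 2≤a 2≤b) 4≤N z≤n    (even-half N even) refl) ,
    (λ odd  → dom-value 2 1 2 {suc (N / 2)} (dom-S-two 13≤N 2≤a 2≤b) 4≤N ≤-refl (odd-half N odd)  refl)
    where 4≤N = ≤-trans (s≤s (s≤s (s≤s (s≤s z≤n)))) 13≤N

  dom-parity-one : 5 ≤ N → ¬ (13 ≤ N × 2 ≤ a × 2 ≤ b) →
                   (N % 2 ≡ 0 → IsDomMaj S -[1+ 1 ]) × (N % 2 ≡ 1 → IsDomMaj S -[1+ 0 ])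
  dom-parity-one 5≤N excluded =
    (λ even → dom-value 1 0 1 {N / 2} (dom-S-one 5≤N excluded) 2≤N z≤n    (even-half N even) refl) ,
    (λ odd  → dom-value 1 1 0 {suc (N / 2)} (dom-S-one 5≤N excluded) 2≤N ≤-refl (odd-half N odd)  refl)
    where 2≤N = ≤-trans (s≤s (s≤s z≤n)) 5≤N

module IsomorphicToDoubleStar (a b : ℕ) (G : Graph (2 + a + b)) (φ : Fin (2 + a + b) ↔ Fin (2 + a + b))
  (adj≡ : ∀ u v → adj G u v ≡ adj (doubleStar a b) (Inverse.to φ u) (Inverse.to φ v)) where
  open DoubleStar a b
  open GraphIso G S φ adj≡ public
  open Inverse φ using (to; from; strictlyInverseˡ)

  no-deg-2 : 1 ≤ a → 1 ≤ b → (∀ v → ¬ (deg G v ≡ 2)) → 2 ≤ a × 2 ≤ b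
  no-deg-2 1≤a 1≤b no-2 = stem-≥2 X deg-X 1≤a , stem-≥2 Y deg-Y 1≤b
    where stem-≥2 : ∀ {m} u → deg S u ≡ suc m → 1 ≤ m → 2 ≤ m
          stem-≥2 u deg≡ 1≤m = ≤∧≢⇒< 1≤m λ 1≡m →
            no-2 (from u) (trans (deg-transfer (from u))
                    (trans (cong (deg S) (strictlyInverseˡ u)) (trans deg≡ (cong suc (≡-sym 1≡m)))))

  small-or-deg-2 : (5 ≤ N × N < 13) ⊎ (13 ≤ N × ∃ λ v → deg G v ≡ 2) →
                   5 ≤ N × ¬ (13 ≤ N × 2 ≤ a × 2 ≤ b)
  small-or-deg-2 (inj₁ (5≤N , N<13)) =
    5≤N , λ (13≤N , _) → <⇒≱ N<13 13≤N
  small-or-deg-2 (inj₂ (13≤N , v , deg-v≡2)) =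
    ≤-trans (s≤s (s≤s (s≤s (s≤s (s≤s z≤n))))) 13≤N ,
    λ (_ , 2≤a , 2≤b) → [ (λ a≡1 → <⇒≱ (subst (1 <_) a≡1 2≤a) ≤-refl) ,
                          (λ b≡1 → <⇒≱ (subst (1 <_) b≡1 2≤b) ≤-refl) ]
                        (deg≡2 (to v) (trans (≡-sym (deg-transfer v)) deg-v≡2))

proposition4p6 : ∀ {n} (G : Graph n) → IsDoubleStar G →
    ((n % 2 ≡ 0 → IsDOMMaj G (+ 0)) × (n % 2 ≡ 1 → IsDOMMaj G (+ 1))) ×
    ((13 ≤ n → (∀ v → ¬ (deg G v ≡ 2)) →
        (n % 2 ≡ 0 → IsDomMaj G -[1+ 3 ]) × (n % 2 ≡ 1 → IsDomMaj G -[1+ 2 ])) ×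
     (((5 ≤ n × n < 13) ⊎ (13 ≤ n × ∃ λ v → deg G v ≡ 2)) →
        (n % 2 ≡ 0 → IsDomMaj G -[1+ 1 ]) × (n % 2 ≡ 1 → IsDomMaj G -[1+ 0 ])))
proposition4p6 G (a , b , 1≤a , 1≤b , φ , adj≡) with ↔⇒≡ φ
... | refl =
  map (DOM-transfer ∘_) (DOM-transfer ∘_) DOM-parity ,
  (λ 13≤N no-2 → let (2≤a , 2≤b) = no-deg-2 1≤a 1≤b no-2 in
                   map (dom-transfer ∘_) (dom-transfer ∘_) (dom-parity-two 13≤N 2≤a 2≤b)) ,
  (λ hyp → let (5≤N , excluded) = small-or-deg-2 hyp in
             map (dom-transfer ∘_) (dom-transfer ∘_) (dom-parity-one 5≤N excluded))
  where
  open DoubleStar a b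
  open IsomorphicToDoubleStar a b G φ adj≡
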